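{- Let $P=\mathcal{Z}_4$ and $x\in P$. Let $\mathcal{O}$ be a promotion orbit of $\mathrm{Inc}^q(P)$ that avoids $1324$. Then $\mathcal{O}$ exhibits orbitmesy with respect to the antipodal sum statistic $\mathcal{A}_x$.
   Context: $\mathcal{Z}_4$ is the zig-zag poset $x_1\lessdot x_2\gtrdot x_3\lessdot x_4$, self-dual with order-reversing involution $\kappa$ exchanging $x_1\leftrightarrow x_4$, $x_2\leftrightarrow x_3$. $\mathrm{Inc}^q(P)$ is the set of increasing labelings $f:P\to[q]$ ($f(x)<f(y)$ whenever $x<y$). Promotion: replace labels $1$ by empty boxes; for $i=2,\dots,q$ slide boxes upward (a box at $x$ becomes $i$ if some $y\gtrdot x$ is labeled $i$, and that element becomes a box); replace boxes by $q+1$ and subtract $1$ from all labels. $\mathcal{A}_x(f)=f(x)+f(\kappa(x))$. A labeling contains pattern $1324$ if its left-to-right word of labels has a subsequence in the same relative order as $1324$; an orbit avoids $1324$ if no labeling in it contains it. Orbitmesy: orbit average of the statistic equals the average over all of $\mathrm{Inc}^q(P)$. -}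

module Defs where

open import Data.Nat using (ℕ; zero; suc; _+_; _*_; _∸_; _≡ᵇ_; _≤ᵇ_; _<ᵇ_)
open import Data.Bool using (Bool; true; false; if_then_else_; _∧_; _∨_; T)
open import Data.Fin using (Fin; zero; suc)
import Data.Fin as F
open import Data.Vec using (Vec; []; _∷_; lookup; tabulate; map)
open import Data.List using (List; []; _∷_; foldl; upTo; concatMap; filter; allFin)
open import Data.Bool.ListAction using (any; all)
open import Data.Nat.ListAction using (sum)
import Data.List as L
open import Data.Maybe using (Maybe; just; nothing; maybe)
open import Data.Product using (Σ; _×_)
import Data.Nat as N
open import Relation.Nullary.Decidable using (does)
open import Data.Bool.Properties using (T?)

-- The zig-zag poset Z₄ : elements x₁,x₂,x₃,x₄ are  zero, 1, 2, 3 : Fin 4,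
-- listed in left-to-right order.  Cover relations:
-- x₁ ⋖ x₂ , x₃ ⋖ x₂ , x₃ ⋖ x₄.
-- covers x y = true  iff  x ⋖ y.
covers : Fin 4 → Fin 4 → Bool
covers zero (suc zero) = true
covers (suc (suc zero)) (suc zero) = true
covers (suc (suc zero)) (suc (suc (suc zero))) = true
covers _ _ = false

-- Strict order of Z₄: since Z₄ has height 2, x < y iff x ⋖ y.
lt : Fin 4 → Fin 4 → Bool
lt = covers

κ : Fin 4 → Fin 4
κ zero = suc (suc (suc zero))
κ (suc zero) = suc (suc zero)
κ (suc (suc zero)) = suc zero
κ (suc (suc (suc zero))) = zero

Labeling : Set
Labeling = Vec ℕ 4

isIncᵇ : ℕ → Labeling → Bool
isIncᵇ q f =
  all (λ x → (1 ≤ᵇ lookup f x) ∧ (lookup f x ≤ᵇ q)) (allFin 4)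
  ∧ all (λ x → all (λ y → if lt x y then lookup f x <ᵇ lookup f y else true) (allFin 4)) (allFin 4)

IsInc : ℕ → Labeling → Set
IsInc q f = T (isIncᵇ q f)

vecs : ℕ → (n : ℕ) → List (Vec ℕ n)
vecs q zero = [] ∷ []
vecs q (suc n) = concatMap (λ a → L.map (a ∷_) (vecs q n)) (L.map suc (upTo q))

incList : ℕ → List Labeling
incList q = filter (λ f → T? (isIncᵇ q f)) (vecs q 4)

-- A box is represented by 'nothing'.
slideStep : ℕ → Vec (Maybe ℕ) 4 → Vec (Maybe ℕ) 4
slideStep i v = tabulate cell
  where
  isI : Maybe ℕ → Bool
  isI nothing = false
  isI (just a) = a ≡ᵇ i
  isBox : Maybe ℕ → Bool
  isBox nothing = true
  isBox (just _) = false
  cell : Fin 4 → Maybe ℕ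
  cell z with lookup v z
  ... | nothing = if any (λ y → covers z y ∧ isI (lookup v y)) (allFin 4) then just i else nothing
  ... | just a = if (a ≡ᵇ i) ∧ any (λ w → covers w z ∧ isBox (lookup v w)) (allFin 4) then nothing else just a

slides : ℕ → Vec (Maybe ℕ) 4 → Vec (Maybe ℕ) 4
slides q v = foldl (λ w i → slideStep i w) v (L.map (2 +_) (upTo (q ∸ 1)))

-- Promotion on Inc^q(Z₄): replace 1's by boxes, slide, replace boxes by q+1,
-- subtract 1 from all labels.
pro : ℕ → Labeling → Labeling
pro q f = map (maybe (λ a → a ∸ 1) q)
              (slides q (map (λ a → if a ≡ᵇ 1 then nothing else just a) f))

pro^ : ℕ → ℕ → Labeling → Labeling
pro^ q zero f = f
pro^ q (suc k) f = pro q (pro^ q k f)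

A : Fin 4 → Labeling → ℕ
A x f = lookup f x + lookup f (κ x)

Contains1324 : Labeling → Set
Contains1324 f =
  Σ (Fin 4) λ i → Σ (Fin 4) λ j → Σ (Fin 4) λ k → Σ (Fin 4) λ l →
    (i F.< j) × (j F.< k) × (k F.< l) ×
    (lookup f i N.< lookup f k) × (lookup f k N.< lookup f j) × (lookup f j N.< lookup f l)

orbitSum : ℕ → Fin 4 → Labeling → ℕ → ℕ
orbitSum q x f n = sum (L.map (λ j → A x (pro^ q j f)) (upTo n))

totalSum : ℕ → Fin 4 → ℕ
totalSum q x = sum (L.map (A x) (incList q))

{-# OPTIONS --safe #-}
module Submission where

-- Complementation f ↦ q + 1 − f ∘ κ is an involution of Inc^q(Z₄) turning A_x(f) into
-- 2(q + 1) − A_x(f), so A_x averages to q + 1 over Inc^q(Z₄).  Along promotion, a potential Φ,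
-- quadratic in q and the four labels on each of four regions cut out by comparing f(x₁) with
-- f(x₃) and f(x₂) with f(x₄), satisfies Φ(pro f) − Φ(f) = A_x(f) − (q + 1) as long as pro f
-- avoids 1324; over a period the sum of A_x therefore telescopes to q + 1 times the period.
-- The identity is checked on the explicit form of promotion, which depends only on which of
-- the minimal elements x₁, x₃ carry the label 1 and on how f(x₂) compares with f(x₄).

open import Defs
open import Algebra.Bundles using (AbelianGroup)
open import Algebra.Bundles.Raw using (RawRing)
open import Data.Nat.Properties
open import Algebra.Properties.CommutativeMonoid.Sum +-0-commutativeMonoid using (∑-comm; ∑-permute; sum-cong-≗; sum-syntax)
import Data.Integer.Properties as ℤP
open import Algebra.Properties.Group (AbelianGroup.group ℤP.+-0-abelianGroup) using (∙-cancelˡ)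
open import Data.Bool using (Bool; true; false; T; if_then_else_; _∧_; _∨_)
open import Data.Bool.ListAction using (all)
open import Data.Bool.Properties using (T-≡; T-∧; ∧-zeroʳ; ∨-zeroʳ)
open import Data.Fin using (Fin; zero; suc; toℕ; opposite)
open import Data.Fin.Permutation using (reverse)
open import Data.Fin.Properties using (opposite-prop; toℕ<n)
import Data.Integer as ℤ
open import Data.Integer using (ℤ; +_; 0ℤ; 1ℤ)
open import Data.Integer.Tactic.RingSolver using (ring) renaming (solve-∀ to ℤ-solve-∀)
open import Data.List using (List; []; _∷_; allFin; applyUpTo; concatMap; filter; length; upTo)
import Data.List as List
open import Data.List.Properties using (map-applyUpTo; map-++; map-∘; map-cong)
open import Data.List.Relation.Unary.All using (_∷_; [])
open import Data.List.Relation.Unary.All.Properties using (all⁺; all⁻)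
open import Data.Maybe using (Maybe; just; nothing; maybe)
open import Data.Nat using (ℕ; zero; suc; _≤_; _<_; z≤n; s≤s; _≤ᵇ_; _<ᵇ_; _≡ᵇ_; _≟_; _≤?_)
open import Data.Nat.ListAction using (sum)
open import Data.Nat.ListAction.Properties using (sum-++)
open import Data.Nat.Tactic.RingSolver using (solve-∀)
open import Data.Product using (_×_; _,_; proj₁; proj₂; uncurry)
open import Data.Vec using (Vec; _∷_; []; lookup)
import Data.Vec as Vec
open import Function using (_∘_; id; const)
open import Function.Bundles using (Equivalence)
open import Level using (0ℓ)
open import Relation.Binary.Definitions using (tri<; tri≈; tri>)
open import Relation.Binary.PropositionalEquality
open import Relation.Nullary using (¬_; contradiction; yes; no)
open import Relation.Nullary.Decidable using (T?)
open import Tactic.RingSolver.NonReflective ring using (solve; Expr; Κ; _⊕_; _⊗_; ⊝_)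

-- The potential

data Pair : Set where
  outer inner : Pair

pairOf : Fin 4 → Pair
pairOf zero                   = outer
pairOf (suc zero)             = inner
pairOf (suc (suc zero))       = inner
pairOf (suc (suc (suc zero))) = outer

data Region : Set where
  r₁ r₂ r₃ r₄ : Region

region : ℕ → ℕ → ℕ → ℕ → Region
region a b c d =
  if a <ᵇ c then r₁ else if b <ᵇ d then r₂ else if (a ≡ᵇ c) ∨ (b ≡ᵇ d) then r₃ else r₄

-- Written over an arbitrary raw ring so that, instantiated at the ring solver's syntax,
-- the step identities can be handed to the non-reflective solver.
module Polynomials (R : RawRing 0ℓ 0ℓ) where
  open RawRing R

  infixl 6 _-_
  _-_ : Carrier → Carrier → Carrier
  x - y = x + - y

  1+_ : Carrier → Carrier
  1+ x = 1# + x

  2# : Carrier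
  2# = 1# + 1#

  σ : Pair → Carrier → Carrier → Carrier → Carrier → Carrier
  σ outer a b c d = a + d
  σ inner a b c d = b + c

  -- Found by solving, for small q, the linear conditions that the step identities below
  -- impose on one quadratic polynomial per region.
  φ : Pair → Region → (q a b c d : Carrier) → Carrier
  φ outer r₁ q a b c d = q * a - q * c + q * d - a * b - 2# * a * c + 2# * a * d + 2# * b * c - b * d + c * c - 2# * c * d
  φ outer r₂ q a b c d = q * b - 2# * a * b - a * c + 2# * a * d + b * b + 2# * b * c - 2# * b * d - c * d
  φ outer r₃ q a b c d = 2# * q * a - q * d + a * c - 2# * a * d - b * c + b * d
  φ outer r₄ q a b c d = 2# * q * a - q * b + q * c - q * d - 2# * a * b + 2# * a * c - a * d
                         + b * b - 2# * b * c + 2# * b * d + c * c - 2# * c * d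
  φ inner r₁ q a b c d = q * c + a * c - a * d - b * c - c * c + c * d
  φ inner r₂ q a b c d = q * c + a * b - a * d - b * b - b * c + b * d
  φ inner r₃ q a b c d = q * c + q * d - q * a - a * c + a * d - b * d
  φ inner r₄ q a b c d = q * b + q * d - q * a + a * b - a * c - b * b + b * c - b * d - c * c + c * d

  balance : Pair → (q : Carrier) → Region → (a′ b′ c′ d′ : Carrier) → Region → (a b c d : Carrier) → Carrier × Carrier
  balance p q r′ a′ b′ c′ d′ r a b c d = φ p r′ q a′ b′ c′ d′ + 1+ q , φ p r q a b c d + σ p a b c d

  balance-no-ones : Pair → Region → (q a b c d : Carrier) → Carrier × Carrier
  balance-no-ones p r q a b c d = balance p q r a b c d r (1+ a) (1+ b) (1+ c) (1+ d)

  balance-one-at-x₁ : Pair → (q b c d : Carrier) → Carrier × Carrier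
  balance-one-at-x₁ p q b c d = balance p q r₄ b q c d r₁ 1# (1+ b) (1+ c) (1+ d)

  balance-one-at-x₃-< : Pair → (q a b d : Carrier) → Carrier × Carrier
  balance-one-at-x₃-< p q a b d = balance p q r₁ a q b d r₂ (1+ a) (1+ b) 1# (1+ d)

  balance-one-at-x₃-≡ : Pair → (q a b : Carrier) → Carrier × Carrier
  balance-one-at-x₃-≡ p q a b = balance p q r₁ a q b q r₃ (1+ a) (1+ b) 1# (1+ b)

  balance-one-at-x₃-> : Pair → (q a b d : Carrier) → Carrier × Carrier
  balance-one-at-x₃-> p q a b d = balance p q r₂ a b d q r₄ (1+ a) (1+ b) 1# (1+ d)

  balance-ones-at-x₁x₃-< : Pair → (q b d : Carrier) → Carrier × Carrier
  balance-ones-at-x₁x₃-< p q b d = balance p q r₃ b q b d r₂ 1# (1+ b) 1# (1+ d)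

  balance-ones-at-x₁x₃-≡ : Pair → (q b : Carrier) → Carrier × Carrier
  balance-ones-at-x₁x₃-≡ p q b = balance p q r₃ b q b q r₃ 1# (1+ b) 1# (1+ b)

  balance-ones-at-x₁x₃-> : Pair → (q b d : Carrier) → Carrier × Carrier
  balance-ones-at-x₁x₃-> p q b d = balance p q r₃ b q d q r₃ 1# (1+ b) 1# (1+ d)

exprRawRing : ℕ → RawRing 0ℓ 0ℓ
exprRawRing n = record
  { Carrier = Expr ℤ n ; _≈_ = _≡_ ; _+_ = _⊕_ ; _*_ = _⊗_ ; -_ = ⊝_ ; 0# = Κ 0ℤ ; 1# = Κ 1ℤ }

module Syntax {n} = Polynomials (exprRawRing n)
open Polynomials ℤ.+-*-rawRing
  using (σ; φ; balance-no-ones; balance-one-at-x₁; balance-one-at-x₃-<; balance-one-at-x₃-≡; balance-one-at-x₃->;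
         balance-ones-at-x₁x₃-<; balance-ones-at-x₁x₃-≡; balance-ones-at-x₁x₃->)

φ-no-ones : ∀ p r q a b c d → uncurry _≡_ (balance-no-ones p r q a b c d)
φ-no-ones outer r₁ = solve 5 (Syntax.balance-no-ones outer r₁) refl
φ-no-ones outer r₂ = solve 5 (Syntax.balance-no-ones outer r₂) refl
φ-no-ones outer r₃ = solve 5 (Syntax.balance-no-ones outer r₃) refl
φ-no-ones outer r₄ = solve 5 (Syntax.balance-no-ones outer r₄) refl
φ-no-ones inner r₁ = solve 5 (Syntax.balance-no-ones inner r₁) refl
φ-no-ones inner r₂ = solve 5 (Syntax.balance-no-ones inner r₂) refl
φ-no-ones inner r₃ = solve 5 (Syntax.balance-no-ones inner r₃) refl
φ-no-ones inner r₄ = solve 5 (Syntax.balance-no-ones inner r₄) refl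

φ-one-at-x₁ : ∀ p q b c d → uncurry _≡_ (balance-one-at-x₁ p q b c d)
φ-one-at-x₁ outer = solve 4 (Syntax.balance-one-at-x₁ outer) refl
φ-one-at-x₁ inner = solve 4 (Syntax.balance-one-at-x₁ inner) refl

φ-one-at-x₃-< : ∀ p q a b d → uncurry _≡_ (balance-one-at-x₃-< p q a b d)
φ-one-at-x₃-< outer = solve 4 (Syntax.balance-one-at-x₃-< outer) refl
φ-one-at-x₃-< inner = solve 4 (Syntax.balance-one-at-x₃-< inner) refl

φ-one-at-x₃-≡ : ∀ p q a b → uncurry _≡_ (balance-one-at-x₃-≡ p q a b)
φ-one-at-x₃-≡ outer = solve 3 (Syntax.balance-one-at-x₃-≡ outer) refl
φ-one-at-x₃-≡ inner = solve 3 (Syntax.balance-one-at-x₃-≡ inner) refl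

φ-one-at-x₃-> : ∀ p q a b d → uncurry _≡_ (balance-one-at-x₃-> p q a b d)
φ-one-at-x₃-> outer = solve 4 (Syntax.balance-one-at-x₃-> outer) refl
φ-one-at-x₃-> inner = solve 4 (Syntax.balance-one-at-x₃-> inner) refl

φ-ones-at-x₁x₃-< : ∀ p q b d → uncurry _≡_ (balance-ones-at-x₁x₃-< p q b d)
φ-ones-at-x₁x₃-< outer = solve 3 (Syntax.balance-ones-at-x₁x₃-< outer) refl
φ-ones-at-x₁x₃-< inner = solve 3 (Syntax.balance-ones-at-x₁x₃-< inner) refl

φ-ones-at-x₁x₃-≡ : ∀ p q b → uncurry _≡_ (balance-ones-at-x₁x₃-≡ p q b)
φ-ones-at-x₁x₃-≡ outer = solve 2 (Syntax.balance-ones-at-x₁x₃-≡ outer) refl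
φ-ones-at-x₁x₃-≡ inner = solve 2 (Syntax.balance-ones-at-x₁x₃-≡ inner) refl

φ-ones-at-x₁x₃-> : ∀ p q b d → uncurry _≡_ (balance-ones-at-x₁x₃-> p q b d)
φ-ones-at-x₁x₃-> outer = solve 3 (Syntax.balance-ones-at-x₁x₃-> outer) refl
φ-ones-at-x₁x₃-> inner = solve 3 (Syntax.balance-ones-at-x₁x₃-> inner) refl

-- Opened only now: inside Polynomials they would clash with the ring operations.
open import Data.Nat using (_+_; _*_; _∸_)

Φ : Pair → ℕ → Labeling → ℤ
Φ p q (a ∷ b ∷ c ∷ d ∷ []) = φ p (region a b c d) (+ q) (+ a) (+ b) (+ c) (+ d)

σ-labels : Pair → Labeling → ℤ
σ-labels p (a ∷ b ∷ c ∷ d ∷ []) = σ p (+ a) (+ b) (+ c) (+ d)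

σ-labels-pairOf : ∀ x g → σ-labels (pairOf x) g ≡ + A x g
σ-labels-pairOf zero                   (a ∷ b ∷ c ∷ d ∷ []) = refl
σ-labels-pairOf (suc zero)             (a ∷ b ∷ c ∷ d ∷ []) = refl
σ-labels-pairOf (suc (suc zero))       (a ∷ b ∷ c ∷ d ∷ []) = cong +_ (+-comm b c)
σ-labels-pairOf (suc (suc (suc zero))) (a ∷ b ∷ c ∷ d ∷ []) = cong +_ (+-comm a d)

¬T⇒≡false : ∀ {b} → ¬ T b → b ≡ false
¬T⇒≡false {false} _  = refl
¬T⇒≡false {true}  ¬t = contradiction _ ¬t

≢⇒≡ᵇ-false : ∀ {m n} → m ≢ n → (m ≡ᵇ n) ≡ false
≢⇒≡ᵇ-false m≢n = ¬T⇒≡false (m≢n ∘ ≡ᵇ⇒≡ _ _)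

≡ᵇ-refl : ∀ n → (n ≡ᵇ n) ≡ true
≡ᵇ-refl n = Equivalence.to T-≡ (≡⇒≡ᵇ n n refl)

<ᵇ-true : ∀ {m n} → m < n → (m <ᵇ n) ≡ true
<ᵇ-true m<n = Equivalence.to T-≡ (<⇒<ᵇ m<n)

<ᵇ-false : ∀ {m n} → n ≤ m → (m <ᵇ n) ≡ false
<ᵇ-false n≤m = ¬T⇒≡false (≤⇒≯ n≤m ∘ <ᵇ⇒< _ _)

region-r₁ : ∀ {a b c d} → a < c → region a b c d ≡ r₁
region-r₁ a<c rewrite <ᵇ-true a<c = refl

region-r₂ : ∀ {a b c d} → c ≤ a → b < d → region a b c d ≡ r₂
region-r₂ c≤a b<d rewrite <ᵇ-false c≤a | <ᵇ-true b<d = refl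

region-r₃ˡ : ∀ {a b d} → d ≤ b → region a b a d ≡ r₃
region-r₃ˡ {a} d≤b rewrite <ᵇ-false {a} ≤-refl | <ᵇ-false d≤b | ≡ᵇ-refl a = refl

region-r₃ʳ : ∀ {a b c} → c ≤ a → region a b c b ≡ r₃
region-r₃ʳ {a} {b} {c} c≤a rewrite <ᵇ-false c≤a | <ᵇ-false {b} ≤-refl | ≡ᵇ-refl b | ∨-zeroʳ (a ≡ᵇ c) = refl

region-r₄ : ∀ {a b c d} → c < a → d < b → region a b c d ≡ r₄
region-r₄ c<a d<b rewrite <ᵇ-false (<⇒≤ c<a) | <ᵇ-false (<⇒≤ d<b)
                        | ≢⇒≡ᵇ-false (<⇒≢ c<a ∘ sym) | ≢⇒≡ᵇ-false (<⇒≢ d<b ∘ sym) = refl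

-- Promotion on Z₄

slidesFrom : ℕ → ℕ → Vec (Maybe ℕ) 4 → Vec (Maybe ℕ) 4
slidesFrom i zero    v = v
slidesFrom i (suc m) v = slidesFrom (suc i) m (slideStep i v)

slides≡slidesFrom : ∀ q v → slides q v ≡ slidesFrom 2 (q ∸ 1) v
slides≡slidesFrom q v =
  trans (cong (foldl-slides v) (map-applyUpTo id (_+_ 2) (q ∸ 1))) (fold≡slidesFrom 2 (_+_ 2) (q ∸ 1) (λ _ → refl) v)
  where
  foldl-slides : Vec (Maybe ℕ) 4 → List ℕ → Vec (Maybe ℕ) 4
  foldl-slides = List.foldl (λ w i → slideStep i w)
  fold≡slidesFrom : ∀ i f m → (∀ j → f j ≡ i + j) → ∀ v → foldl-slides v (applyUpTo f m) ≡ slidesFrom i m v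
  fold≡slidesFrom i f zero    f≗ v = refl
  fold≡slidesFrom i f (suc m) f≗ v rewrite f≗ 0 | +-identityʳ i =
    fold≡slidesFrom (suc i) (f ∘ suc) m (λ j → trans (f≗ (suc j)) (+-suc i j)) (slideStep i v)

slidesFrom-stable : ∀ {v} → (∀ i → slideStep i v ≡ v) → ∀ i m → slidesFrom i m v ≡ v
slidesFrom-stable stable i zero    = refl
slidesFrom-stable stable i (suc m) rewrite stable i = slidesFrom-stable stable (suc i) m

slidesFrom-idle : ∀ {v} i n m → (∀ j → i ≤ j → j < i + n → slideStep j v ≡ v) →
                  slidesFrom i (n + m) v ≡ slidesFrom (i + n) m v
slidesFrom-idle i zero    m idle rewrite +-identityʳ i = refl
slidesFrom-idle i (suc n) m idle rewrite idle i ≤-refl (m<m+n i (s≤s z≤n)) | +-suc i n =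
  slidesFrom-idle (suc i) n m (λ j i<j → idle j (<⇒≤ i<j))

slidesFrom-hit : ∀ {v} i k m → i ≤ k → k < i + m → (∀ j → i ≤ j → j < k → slideStep j v ≡ v) →
                 slidesFrom i m v ≡ slidesFrom (suc k) (i + m ∸ suc k) (slideStep k v)
slidesFrom-hit {v} i k m i≤k k<i+m idle = begin
  slidesFrom i m v                       ≡⟨ cong (λ m → slidesFrom i m v) m≡n+[1+r] ⟩
  slidesFrom i (n + suc r) v             ≡⟨ slidesFrom-idle i n (suc r) (λ j i≤j j<i+n → idle j i≤j (subst (j <_) i+n≡k j<i+n)) ⟩
  slidesFrom (i + n) (suc r) v           ≡⟨ cong (λ j → slidesFrom j (suc r) v) i+n≡k ⟩
  slidesFrom k (suc r) v                 ∎
  where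
  open ≡-Reasoning
  n = k ∸ i
  r = i + m ∸ suc k
  i+n≡k : i + n ≡ k
  i+n≡k = m+[n∸m]≡n i≤k
  rearrange : ∀ i n r → suc (i + n) + r ≡ i + (n + suc r)
  rearrange = solve-∀
  m≡n+[1+r] : m ≡ n + suc r
  m≡n+[1+r] = +-cancelˡ-≡ i m (n + suc r)
    (trans (sym (m+[n∸m]≡n k<i+m)) (trans (cong (λ j → suc j + r) (sym i+n≡k)) (rearrange i n r)))

slidesFrom-settles : ∀ {v w} i k m → i ≤ k → k < i + m → (∀ j → i ≤ j → j < k → slideStep j v ≡ v) →
                     slideStep k v ≡ w → (∀ j → slideStep j w ≡ w) → slidesFrom i m v ≡ w
slidesFrom-settles {v} {w} i k m i≤k k<i+m idle hit stable = begin
  slidesFrom i m v                                   ≡⟨ slidesFrom-hit i k m i≤k k<i+m idle ⟩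
  slidesFrom (suc k) (i + m ∸ suc k) (slideStep k v) ≡⟨ cong (slidesFrom (suc k) (i + m ∸ suc k)) hit ⟩
  slidesFrom (suc k) (i + m ∸ suc k) w               ≡⟨ slidesFrom-stable stable (suc k) (i + m ∸ suc k) ⟩
  w                                                  ∎
  where open ≡-Reasoning

≤⇒<2+[∸1] : ∀ {k} q → k ≤ q → k < 2 + (q ∸ 1)
≤⇒<2+[∸1] zero    k≤0 = ≤-trans (s≤s k≤0) (n≤1+n 1)
≤⇒<2+[∸1] (suc q) k≤q = s≤s k≤q

slides-settles : ∀ {v w} q k → 2 ≤ k → k ≤ q → (∀ j → 2 ≤ j → j < k → slideStep j v ≡ v) →
                 slideStep k v ≡ w → (∀ j → slideStep j w ≡ w) → slides q v ≡ w
slides-settles {v} q k 2≤k k≤q idle hit stable =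
  trans (slides≡slidesFrom q v) (slidesFrom-settles 2 k (q ∸ 1) 2≤k (≤⇒<2+[∸1] q k≤q) idle hit stable)

slideStep-stable : ∀ i a c u w → slideStep i (just a ∷ u ∷ just c ∷ w ∷ []) ≡ (just a ∷ u ∷ just c ∷ w ∷ [])
slideStep-stable i a c nothing  nothing  rewrite ∧-zeroʳ (a ≡ᵇ i) | ∧-zeroʳ (c ≡ᵇ i) = refl
slideStep-stable i a c nothing  (just d) rewrite ∧-zeroʳ (a ≡ᵇ i) | ∧-zeroʳ (c ≡ᵇ i) | ∧-zeroʳ (d ≡ᵇ i) = refl
slideStep-stable i a c (just b) nothing  rewrite ∧-zeroʳ (a ≡ᵇ i) | ∧-zeroʳ (b ≡ᵇ i) | ∧-zeroʳ (c ≡ᵇ i) = refl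
slideStep-stable i a c (just b) (just d)
  rewrite ∧-zeroʳ (a ≡ᵇ i) | ∧-zeroʳ (b ≡ᵇ i) | ∧-zeroʳ (c ≡ᵇ i) | ∧-zeroʳ (d ≡ᵇ i) = refl

slideStep-x₁-idle : ∀ {i b} c w → b ≢ i →
                    slideStep i (nothing ∷ just b ∷ just c ∷ w ∷ []) ≡ (nothing ∷ just b ∷ just c ∷ w ∷ [])
slideStep-x₁-idle {i} c nothing  b≢i rewrite ≢⇒≡ᵇ-false b≢i | ∧-zeroʳ (c ≡ᵇ i) = refl
slideStep-x₁-idle {i} c (just d) b≢i rewrite ≢⇒≡ᵇ-false b≢i | ∧-zeroʳ (c ≡ᵇ i) | ∧-zeroʳ (d ≡ᵇ i) = refl

slideStep-x₁-hit : ∀ b c w → slideStep b (nothing ∷ just b ∷ just c ∷ w ∷ []) ≡ (just b ∷ nothing ∷ just c ∷ w ∷ [])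
slideStep-x₁-hit b c nothing  rewrite ≡ᵇ-refl b | ∧-zeroʳ (c ≡ᵇ b) = refl
slideStep-x₁-hit b c (just d) rewrite ≡ᵇ-refl b | ∧-zeroʳ (c ≡ᵇ b) | ∧-zeroʳ (d ≡ᵇ b) = refl

slideStep-x₃-idle : ∀ {i b d} u → b ≢ i → d ≢ i →
                    slideStep i (u ∷ just b ∷ nothing ∷ just d ∷ []) ≡ (u ∷ just b ∷ nothing ∷ just d ∷ [])
slideStep-x₃-idle     nothing  b≢i d≢i rewrite ≢⇒≡ᵇ-false b≢i | ≢⇒≡ᵇ-false d≢i = refl
slideStep-x₃-idle {i} (just a) b≢i d≢i rewrite ∧-zeroʳ (a ≡ᵇ i) | ≢⇒≡ᵇ-false b≢i | ≢⇒≡ᵇ-false d≢i = refl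

slideStep-x₃-hit-x₂ : ∀ a {b d} → d ≢ b →
                      slideStep b (just a ∷ just b ∷ nothing ∷ just d ∷ []) ≡ (just a ∷ nothing ∷ just b ∷ just d ∷ [])
slideStep-x₃-hit-x₂ a {b} d≢b rewrite ∧-zeroʳ (a ≡ᵇ b) | ≡ᵇ-refl b | ≢⇒≡ᵇ-false d≢b = refl

slideStep-x₃-hit-x₂x₄ : ∀ a b →
                        slideStep b (just a ∷ just b ∷ nothing ∷ just b ∷ []) ≡ (just a ∷ nothing ∷ just b ∷ nothing ∷ [])
slideStep-x₃-hit-x₂x₄ a b rewrite ∧-zeroʳ (a ≡ᵇ b) | ≡ᵇ-refl b = refl

slideStep-x₃-hit-x₄ : ∀ u {b d} → b ≢ d →
                      slideStep d (u ∷ just b ∷ nothing ∷ just d ∷ []) ≡ (u ∷ just b ∷ just d ∷ nothing ∷ [])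
slideStep-x₃-hit-x₄ nothing  {b} {d} b≢d rewrite ≢⇒≡ᵇ-false b≢d | ≡ᵇ-refl d = refl
slideStep-x₃-hit-x₄ (just a) {b} {d} b≢d rewrite ∧-zeroʳ (a ≡ᵇ d) | ≢⇒≡ᵇ-false b≢d | ≡ᵇ-refl d = refl

slideStep-x₁x₃-hit-x₂ : ∀ {b d} → d ≢ b →
                        slideStep b (nothing ∷ just b ∷ nothing ∷ just d ∷ []) ≡ (just b ∷ nothing ∷ just b ∷ just d ∷ [])
slideStep-x₁x₃-hit-x₂ {b} d≢b rewrite ≡ᵇ-refl b | ≢⇒≡ᵇ-false d≢b = refl

slideStep-x₁x₃-hit-x₂x₄ : ∀ b →
                          slideStep b (nothing ∷ just b ∷ nothing ∷ just b ∷ []) ≡ (just b ∷ nothing ∷ just b ∷ nothing ∷ [])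
slideStep-x₁x₃-hit-x₂x₄ b rewrite ≡ᵇ-refl b = refl

unbox : ℕ → Maybe ℕ → ℕ
unbox q = maybe (_∸ 1) q

pro-no-ones : ∀ q a b c d → pro q (2 + a ∷ 2 + b ∷ 2 + c ∷ 2 + d ∷ []) ≡ (1 + a ∷ 1 + b ∷ 1 + c ∷ 1 + d ∷ [])
pro-no-ones q a b c d = cong (Vec.map (unbox q)) (trans (slides≡slidesFrom q _)
  (slidesFrom-stable (λ i → slideStep-stable i (2 + a) (2 + c) (just (2 + b)) (just (2 + d))) 2 (q ∸ 1)))

pro-one-at-x₁ : ∀ q b c d → 2 + b ≤ q → pro q (1 ∷ 2 + b ∷ 2 + c ∷ 2 + d ∷ []) ≡ (1 + b ∷ q ∷ 1 + c ∷ 1 + d ∷ [])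
pro-one-at-x₁ q b c d b≤q = cong (Vec.map (unbox q)) (slides-settles q (2 + b) (s≤s (s≤s z≤n)) b≤q
  (λ j _ j<2+b → slideStep-x₁-idle (2 + c) (just (2 + d)) (>⇒≢ j<2+b))
  (slideStep-x₁-hit (2 + b) (2 + c) (just (2 + d)))
  (λ i → slideStep-stable i (2 + b) (2 + c) nothing (just (2 + d))))

pro-one-at-x₃-< : ∀ q a b d → b < d → 2 + d ≤ q →
                  pro q (2 + a ∷ 2 + b ∷ 1 ∷ 2 + d ∷ []) ≡ (1 + a ∷ q ∷ 1 + b ∷ 1 + d ∷ [])
pro-one-at-x₃-< q a b d b<d d≤q = cong (Vec.map (unbox q)) (slides-settles q (2 + b) (s≤s (s≤s z≤n)) (<⇒≤ (<-≤-trans 2+b<2+d d≤q))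
  (λ j _ j<2+b → slideStep-x₃-idle (just (2 + a)) (>⇒≢ j<2+b) (>⇒≢ (<-trans j<2+b 2+b<2+d)))
  (slideStep-x₃-hit-x₂ (2 + a) (>⇒≢ 2+b<2+d))
  (λ i → slideStep-stable i (2 + a) (2 + b) nothing (just (2 + d))))
  where 2+b<2+d = s≤s (s≤s b<d)

pro-one-at-x₃-≡ : ∀ q a b → 2 + b ≤ q →
                  pro q (2 + a ∷ 2 + b ∷ 1 ∷ 2 + b ∷ []) ≡ (1 + a ∷ q ∷ 1 + b ∷ q ∷ [])
pro-one-at-x₃-≡ q a b b≤q = cong (Vec.map (unbox q)) (slides-settles q (2 + b) (s≤s (s≤s z≤n)) b≤q
  (λ j _ j<2+b → slideStep-x₃-idle (just (2 + a)) (>⇒≢ j<2+b) (>⇒≢ j<2+b))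
  (slideStep-x₃-hit-x₂x₄ (2 + a) (2 + b))
  (λ i → slideStep-stable i (2 + a) (2 + b) nothing nothing))

pro-one-at-x₃-> : ∀ q a b d → d < b → 2 + b ≤ q →
                  pro q (2 + a ∷ 2 + b ∷ 1 ∷ 2 + d ∷ []) ≡ (1 + a ∷ 1 + b ∷ 1 + d ∷ q ∷ [])
pro-one-at-x₃-> q a b d d<b b≤q = cong (Vec.map (unbox q)) (slides-settles q (2 + d) (s≤s (s≤s z≤n)) (<⇒≤ (<-≤-trans 2+d<2+b b≤q))
  (λ j _ j<2+d → slideStep-x₃-idle (just (2 + a)) (>⇒≢ (<-trans j<2+d 2+d<2+b)) (>⇒≢ j<2+d))
  (slideStep-x₃-hit-x₄ (just (2 + a)) (>⇒≢ 2+d<2+b))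
  (λ i → slideStep-stable i (2 + a) (2 + d) (just (2 + b)) nothing))
  where 2+d<2+b = s≤s (s≤s d<b)

pro-ones-at-x₁x₃-< : ∀ q b d → b < d → 2 + d ≤ q →
                     pro q (1 ∷ 2 + b ∷ 1 ∷ 2 + d ∷ []) ≡ (1 + b ∷ q ∷ 1 + b ∷ 1 + d ∷ [])
pro-ones-at-x₁x₃-< q b d b<d d≤q = cong (Vec.map (unbox q)) (slides-settles q (2 + b) (s≤s (s≤s z≤n)) (<⇒≤ (<-≤-trans 2+b<2+d d≤q))
  (λ j _ j<2+b → slideStep-x₃-idle nothing (>⇒≢ j<2+b) (>⇒≢ (<-trans j<2+b 2+b<2+d)))
  (slideStep-x₁x₃-hit-x₂ (>⇒≢ 2+b<2+d))
  (λ i → slideStep-stable i (2 + b) (2 + b) nothing (just (2 + d))))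
  where 2+b<2+d = s≤s (s≤s b<d)

pro-ones-at-x₁x₃-≡ : ∀ q b → 2 + b ≤ q →
                     pro q (1 ∷ 2 + b ∷ 1 ∷ 2 + b ∷ []) ≡ (1 + b ∷ q ∷ 1 + b ∷ q ∷ [])
pro-ones-at-x₁x₃-≡ q b b≤q = cong (Vec.map (unbox q)) (slides-settles q (2 + b) (s≤s (s≤s z≤n)) b≤q
  (λ j _ j<2+b → slideStep-x₃-idle nothing (>⇒≢ j<2+b) (>⇒≢ j<2+b))
  (slideStep-x₁x₃-hit-x₂x₄ (2 + b))
  (λ i → slideStep-stable i (2 + b) (2 + b) nothing nothing))

pro-ones-at-x₁x₃-> : ∀ q b d → d < b → 2 + b ≤ q →
                     pro q (1 ∷ 2 + b ∷ 1 ∷ 2 + d ∷ []) ≡ (1 + b ∷ q ∷ 1 + d ∷ q ∷ [])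
pro-ones-at-x₁x₃-> q b d d<b b≤q = cong (Vec.map (unbox q)) (begin
  slides q (nothing ∷ just (2 + b) ∷ nothing ∷ just (2 + d) ∷ [])
    ≡⟨ slides≡slidesFrom q _ ⟩
  slidesFrom 2 (q ∸ 1) (nothing ∷ just (2 + b) ∷ nothing ∷ just (2 + d) ∷ [])
    ≡⟨ slidesFrom-hit 2 (2 + d) (q ∸ 1) (s≤s (s≤s z≤n)) (≤⇒<2+[∸1] q d≤q)
         (λ j _ j<2+d → slideStep-x₃-idle nothing (>⇒≢ (<-trans j<2+d 2+d<2+b)) (>⇒≢ j<2+d)) ⟩
  slidesFrom (3 + d) (end ∸ (3 + d)) (slideStep (2 + d) (nothing ∷ just (2 + b) ∷ nothing ∷ just (2 + d) ∷ []))
    ≡⟨ cong (slidesFrom (3 + d) (end ∸ (3 + d))) (slideStep-x₃-hit-x₄ nothing (>⇒≢ 2+d<2+b)) ⟩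
  slidesFrom (3 + d) (end ∸ (3 + d)) (nothing ∷ just (2 + b) ∷ just (2 + d) ∷ nothing ∷ [])
    ≡⟨ slidesFrom-settles (3 + d) (2 + b) (end ∸ (3 + d)) 2+d<2+b
         (subst (2 + b <_) (sym (m+[n∸m]≡n (≤⇒<2+[∸1] q d≤q))) (≤⇒<2+[∸1] q b≤q))
         (λ j _ j<2+b → slideStep-x₁-idle (2 + d) nothing (>⇒≢ j<2+b))
         (slideStep-x₁-hit (2 + b) (2 + d) nothing)
         (λ i → slideStep-stable i (2 + b) (2 + d) nothing nothing) ⟩
  (just (2 + b) ∷ nothing ∷ just (2 + d) ∷ nothing ∷ []) ∎)
  where
  open ≡-Reasoning
  end = 2 + (q ∸ 1)
  2+d<2+b = s≤s (s≤s d<b)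
  d≤q = <⇒≤ (<-≤-trans 2+d<2+b b≤q)

-- Increasing labelings

Increasing : ℕ → Labeling → Set
Increasing q (a ∷ b ∷ c ∷ d ∷ []) = 1 ≤ a × a < b × 1 ≤ c × c < b × c < d × b ≤ q × d ≤ q

module _ (q : ℕ) (f : Labeling) where
  inRangeᵇ : Fin 4 → Bool
  inRangeᵇ x = (1 ≤ᵇ lookup f x) ∧ (lookup f x ≤ᵇ q)

  coverᵇ : Fin 4 → Fin 4 → Bool
  coverᵇ x y = if lt x y then lookup f x <ᵇ lookup f y else true

T-inRange⇒≤ : ∀ {q x} → T ((1 ≤ᵇ x) ∧ (x ≤ᵇ q)) → 1 ≤ x × x ≤ q
T-inRange⇒≤ {q} {x} r with Equivalence.to T-∧ r
... | 1≤ᵇx , x≤ᵇq = ≤ᵇ⇒≤ 1 x 1≤ᵇx , ≤ᵇ⇒≤ x q x≤ᵇq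

≤⇒T-inRange : ∀ {q x} → 1 ≤ x → x ≤ q → T ((1 ≤ᵇ x) ∧ (x ≤ᵇ q))
≤⇒T-inRange 1≤x x≤q = Equivalence.from T-∧ (≤⇒≤ᵇ 1≤x , ≤⇒≤ᵇ x≤q)

IsInc⇒Increasing : ∀ {q} f → IsInc q f → Increasing q f
IsInc⇒Increasing {q} f@(a ∷ b ∷ c ∷ d ∷ []) inc
  with Equivalence.to T-∧ inc
... | inRange , ordered
  with all⁺ (inRangeᵇ q f) (allFin 4) inRange | all⁺ (λ x → all (coverᵇ q f x) (allFin 4)) (allFin 4) ordered
... | ra ∷ rb ∷ rc ∷ rd ∷ [] | ox₁ ∷ _ ∷ ox₃ ∷ _ ∷ []
  with all⁺ (coverᵇ q f zero) (allFin 4) ox₁ | all⁺ (coverᵇ q f (suc (suc zero))) (allFin 4) ox₃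
... | _ ∷ a<b ∷ _ | _ ∷ c<b ∷ _ ∷ c<d ∷ [] =
  proj₁ (T-inRange⇒≤ ra) , <ᵇ⇒< a b a<b , proj₁ (T-inRange⇒≤ rc) , <ᵇ⇒< c b c<b , <ᵇ⇒< c d c<d ,
  proj₂ (T-inRange⇒≤ rb) , proj₂ (T-inRange⇒≤ rd)

Increasing⇒IsInc : ∀ {q} f → Increasing q f → IsInc q f
Increasing⇒IsInc {q} f@(a ∷ b ∷ c ∷ d ∷ []) (1≤a , a<b , 1≤c , c<b , c<d , b≤q , d≤q) =
  Equivalence.from T-∧
    ( all⁻ (inRangeᵇ q f) {allFin 4}
        (≤⇒T-inRange 1≤a a≤q ∷ ≤⇒T-inRange 1≤b b≤q ∷ ≤⇒T-inRange 1≤c c≤q ∷ ≤⇒T-inRange 1≤d d≤q ∷ [])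
    , all⁻ (λ x → all (coverᵇ q f x) (allFin 4)) {allFin 4}
        ( all⁻ (coverᵇ q f zero) {allFin 4} (_ ∷ <⇒<ᵇ a<b ∷ _ ∷ _ ∷ [])
        ∷ all⁻ (coverᵇ q f (suc zero)) {allFin 4} (_ ∷ _ ∷ _ ∷ _ ∷ [])
        ∷ all⁻ (coverᵇ q f (suc (suc zero))) {allFin 4} (_ ∷ <⇒<ᵇ c<b ∷ _ ∷ <⇒<ᵇ c<d ∷ [])
        ∷ all⁻ (coverᵇ q f (suc (suc (suc zero)))) {allFin 4} (_ ∷ _ ∷ _ ∷ _ ∷ [])
        ∷ []))
  where
  a≤q = ≤-trans (<⇒≤ a<b) b≤q
  c≤q = ≤-trans (<⇒≤ c<b) b≤q
  1≤b = ≤-trans 1≤a (<⇒≤ a<b)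
  1≤d = ≤-trans 1≤c (<⇒≤ c<d)

data Shape : Labeling → Set where
  no-ones      : ∀ a b c d → Shape (2 + a ∷ 2 + b ∷ 2 + c ∷ 2 + d ∷ [])
  one-at-x₁    : ∀ b c d   → Shape (1 ∷ 2 + b ∷ 2 + c ∷ 2 + d ∷ [])
  one-at-x₃    : ∀ a b d   → Shape (2 + a ∷ 2 + b ∷ 1 ∷ 2 + d ∷ [])
  ones-at-x₁x₃ : ∀ b d     → Shape (1 ∷ 2 + b ∷ 1 ∷ 2 + d ∷ [])

shape : ∀ {q} g → Increasing q g → Shape g
shape (suc (suc a) ∷ suc (suc b) ∷ suc (suc c) ∷ suc (suc d) ∷ []) _ = no-ones a b c d
shape (suc zero    ∷ suc (suc b) ∷ suc (suc c) ∷ suc (suc d) ∷ []) _ = one-at-x₁ b c d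
shape (suc (suc a) ∷ suc (suc b) ∷ suc zero    ∷ suc (suc d) ∷ []) _ = one-at-x₃ a b d
shape (suc zero    ∷ suc (suc b) ∷ suc zero    ∷ suc (suc d) ∷ []) _ = ones-at-x₁x₃ b d
shape (zero  ∷ _ ∷ _ ∷ _ ∷ []) (() , _)
shape (_ ∷ _ ∷ zero ∷ _ ∷ []) (_ , _ , () , _)
shape (suc _ ∷ zero ∷ _ ∷ _ ∷ []) (_ , () , _)
shape (suc _ ∷ suc zero ∷ _ ∷ _ ∷ []) (_ , s≤s () , _)
shape (_ ∷ _ ∷ suc _ ∷ zero ∷ []) (_ , _ , _ , _ , () , _)
shape (_ ∷ _ ∷ suc _ ∷ suc zero ∷ []) (_ , _ , _ , _ , s≤s () , _)

pro-increasing : ∀ {q} g → Increasing q g → Increasing q (pro q g)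
pro-increasing {q} g inc with shape g inc
pro-increasing {q} _ (_ , a<b , _ , c<b , c<d , b≤q , d≤q) | no-ones a b c d rewrite pro-no-ones q a b c d =
  s≤s z≤n , ≤-pred a<b , s≤s z≤n , ≤-pred c<b , ≤-pred c<d , <⇒≤ b≤q , <⇒≤ d≤q
pro-increasing {q} _ (_ , _ , _ , c<b , c<d , b≤q , d≤q) | one-at-x₁ b c d rewrite pro-one-at-x₁ q b c d b≤q =
  s≤s z≤n , b≤q , s≤s z≤n , <-trans (≤-pred c<b) b≤q , ≤-pred c<d , ≤-refl , <⇒≤ d≤q
pro-increasing {q} _ (_ , a<b , _ , _ , _ , b≤q , d≤q) | one-at-x₃ a b d with <-cmp b d
... | tri< b<d _ _ rewrite pro-one-at-x₃-< q a b d b<d d≤q =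
  s≤s z≤n , <-trans (≤-pred a<b) 1+b<q , s≤s z≤n , 1+b<q , s≤s b<d , ≤-refl , <⇒≤ d≤q
  where 1+b<q = <-trans (s≤s b<d) d≤q
... | tri≈ _ refl _ rewrite pro-one-at-x₃-≡ q a b b≤q =
  s≤s z≤n , <-trans (≤-pred a<b) b≤q , s≤s z≤n , b≤q , b≤q , ≤-refl , ≤-refl
... | tri> _ _ d<b rewrite pro-one-at-x₃-> q a b d d<b b≤q =
  s≤s z≤n , ≤-pred a<b , s≤s z≤n , s≤s d<b , <-trans (s≤s d<b) b≤q , <⇒≤ b≤q , ≤-refl
pro-increasing {q} _ (_ , _ , _ , _ , _ , b≤q , d≤q) | ones-at-x₁x₃ b d with <-cmp b d
... | tri< b<d _ _ rewrite pro-ones-at-x₁x₃-< q b d b<d d≤q =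
  s≤s z≤n , 1+b<q , s≤s z≤n , 1+b<q , s≤s b<d , ≤-refl , <⇒≤ d≤q
  where 1+b<q = <-trans (s≤s b<d) d≤q
... | tri≈ _ refl _ rewrite pro-ones-at-x₁x₃-≡ q b b≤q =
  s≤s z≤n , b≤q , s≤s z≤n , b≤q , b≤q , ≤-refl , ≤-refl
... | tri> _ _ d<b rewrite pro-ones-at-x₁x₃-> q b d d<b b≤q =
  s≤s z≤n , b≤q , s≤s z≤n , <-trans (s≤s d<b) b≤q , <-trans (s≤s d<b) b≤q , ≤-refl , ≤-refl

pro^-increasing : ∀ {q f} → Increasing q f → ∀ j → Increasing q (pro^ q j f)
pro^-increasing inc zero    = inc
pro^-increasing inc (suc j) = pro-increasing _ (pro^-increasing inc j)

contains1324 : ∀ {a b c d} → a < c → c < b → b < d → Contains1324 (a ∷ b ∷ c ∷ d ∷ [])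
contains1324 a<c c<b b<d = zero , suc zero , suc (suc zero) , suc (suc (suc zero)) ,
  s≤s z≤n , s≤s (s≤s z≤n) , s≤s (s≤s (s≤s z≤n)) , a<c , c<b , b<d

-- The hypothesis on pro q g is needed only when g = (a, b, 1, d) with a < d < b: then pro q g
-- contains 1324 and lies in region r₁ instead of r₂.
Φ-step : ∀ p q g → Increasing q g → ¬ Contains1324 (pro q g) →
         Φ p q (pro q g) ℤ.+ ℤ.suc (+ q) ≡ Φ p q g ℤ.+ σ-labels p g
Φ-step p q g inc avoids with shape g inc
Φ-step p q _ _ _ | no-ones a b c d rewrite pro-no-ones q a b c d =
  φ-no-ones p (region a b c d) (+ q) (+ suc a) (+ suc b) (+ suc c) (+ suc d)
Φ-step p q _ (_ , _ , _ , c<b , _ , b≤q , d≤q) _ | one-at-x₁ b c d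
  rewrite pro-one-at-x₁ q b c d b≤q | region-r₄ {suc b} {q} {suc c} {suc d} (≤-pred c<b) d≤q =
  φ-one-at-x₁ p (+ q) (+ suc b) (+ suc c) (+ suc d)
Φ-step p q _ (_ , a<b , _ , _ , _ , b≤q , d≤q) avoids | one-at-x₃ a b d with <-cmp b d
... | tri< b<d _ _
  rewrite pro-one-at-x₃-< q a b d b<d d≤q | region-r₁ {suc a} {q} {suc b} {suc d} (≤-pred a<b)
        | region-r₂ {2 + a} {2 + b} {1} {2 + d} (s≤s z≤n) (s≤s (s≤s b<d)) =
  φ-one-at-x₃-< p (+ q) (+ suc a) (+ suc b) (+ suc d)
... | tri≈ _ refl _
  rewrite pro-one-at-x₃-≡ q a b b≤q | region-r₁ {suc a} {q} {suc b} {q} (≤-pred a<b)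
        | region-r₃ʳ {2 + a} {2 + b} {1} (s≤s z≤n) =
  φ-one-at-x₃-≡ p (+ q) (+ suc a) (+ suc b)
... | tri> _ _ d<b with d ≤? a
...   | no d≰a = contradiction
  (subst Contains1324 (sym (pro-one-at-x₃-> q a b d d<b b≤q)) (contains1324 (s≤s (≰⇒> d≰a)) (s≤s d<b) b≤q)) avoids
...   | yes d≤a
  rewrite pro-one-at-x₃-> q a b d d<b b≤q | region-r₂ {suc a} {suc b} {suc d} {q} (s≤s d≤a) b≤q
        | region-r₄ {2 + a} {2 + b} {1} {2 + d} (s≤s (s≤s z≤n)) (s≤s (s≤s d<b)) =
  φ-one-at-x₃-> p (+ q) (+ suc a) (+ suc b) (+ suc d)
Φ-step p q _ (_ , _ , _ , _ , _ , b≤q , d≤q) _ | ones-at-x₁x₃ b d with <-cmp b d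
... | tri< b<d _ _
  rewrite pro-ones-at-x₁x₃-< q b d b<d d≤q | region-r₃ˡ {suc b} {q} {suc d} (<⇒≤ d≤q)
        | region-r₂ {1} {2 + b} {1} {2 + d} ≤-refl (s≤s (s≤s b<d)) =
  φ-ones-at-x₁x₃-< p (+ q) (+ suc b) (+ suc d)
... | tri≈ _ refl _
  rewrite pro-ones-at-x₁x₃-≡ q b b≤q | region-r₃ˡ {suc b} {q} {q} ≤-refl | region-r₃ˡ {1} {2 + b} {2 + b} ≤-refl =
  φ-ones-at-x₁x₃-≡ p (+ q) (+ suc b)
... | tri> _ _ d<b
  rewrite pro-ones-at-x₁x₃-> q b d d<b b≤q | region-r₃ʳ {suc b} {q} {suc d} (s≤s (<⇒≤ d<b))
        | region-r₃ˡ {1} {2 + b} {2 + d} (s≤s (s≤s (<⇒≤ d<b))) =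
  φ-ones-at-x₁x₃-> p (+ q) (+ suc b) (+ suc d)

-- Sums

module _ {X : Set} where

  sum-map-applyUpTo : ∀ (g : X → ℕ) f n → sum (List.map g (applyUpTo f n)) ≡ ∑[ i < n ] g (f (toℕ i))
  sum-map-applyUpTo g f zero    = refl
  sum-map-applyUpTo g f (suc n) = cong (_+_ (g (f 0))) (sum-map-applyUpTo g (f ∘ suc) n)

  sum-map-concatMap : ∀ (h : X → ℕ) {Y : Set} (F : Y → List X) ys →
                      sum (List.map h (concatMap F ys)) ≡ sum (List.map (λ y → sum (List.map h (F y))) ys)
  sum-map-concatMap h F []       = refl
  sum-map-concatMap h F (y ∷ ys) = begin
    sum (List.map h (F y List.++ concatMap F ys))              ≡⟨ cong sum (map-++ h (F y) (concatMap F ys)) ⟩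
    sum (List.map h (F y) List.++ List.map h (concatMap F ys)) ≡⟨ sum-++ (List.map h (F y)) _ ⟩
    sum (List.map h (F y)) + sum (List.map h (concatMap F ys)) ≡⟨ cong (_+_ (sum (List.map h (F y)))) (sum-map-concatMap h F ys) ⟩
    sum (List.map h (F y)) + sum (List.map (λ y → sum (List.map h (F y))) ys) ∎
    where open ≡-Reasoning

  sum-map-+ : ∀ (g h : X → ℕ) xs → sum (List.map (λ x → g x + h x) xs) ≡ sum (List.map g xs) + sum (List.map h xs)
  sum-map-+ g h []       = refl
  sum-map-+ g h (x ∷ xs) rewrite sum-map-+ g h xs = shuffle (g x) (h x) (sum (List.map g xs)) (sum (List.map h xs))
    where
    shuffle : ∀ a b c d → a + b + (c + d) ≡ a + c + (b + d)
    shuffle = solve-∀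

  sum-map-* : ∀ k (g : X → ℕ) xs → sum (List.map (λ x → k * g x) xs) ≡ k * sum (List.map g xs)
  sum-map-* k g []       = sym (*-zeroʳ k)
  sum-map-* k g (x ∷ xs) rewrite sum-map-* k g xs = sym (*-distribˡ-+ k (g x) (sum (List.map g xs)))

  sum-map-filter : ∀ (p : X → Bool) (g : X → ℕ) xs →
                   sum (List.map g (filter (T? ∘ p) xs)) ≡ sum (List.map (λ x → if p x then g x else 0) xs)
  sum-map-filter p g []       = refl
  sum-map-filter p g (x ∷ xs) with p x
  ... | true  = cong (_+_ (g x)) (sum-map-filter p g xs)
  ... | false = sum-map-filter p g xs

  length-filter : ∀ (p : X → Bool) xs → length (filter (T? ∘ p) xs) ≡ sum (List.map (λ x → if p x then 1 else 0) xs)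
  length-filter p []       = refl
  length-filter p (x ∷ xs) with p x
  ... | true  = cong suc (length-filter p xs)
  ... | false = length-filter p xs

telescope : ∀ n (s : ℕ → ℕ) (Ψ : ℕ → ℤ) m → (∀ j → j < n → Ψ (suc j) ℤ.+ + m ≡ Ψ j ℤ.+ + s j) →
            + (∑[ j < n ] s (toℕ j)) ℤ.+ Ψ 0 ≡ Ψ n ℤ.+ + (n * m)
telescope zero    s Ψ m step = ℤP.+-comm (+ 0) (Ψ 0)
telescope (suc n) s Ψ m step = begin
  + s 0 ℤ.+ + Σ′ ℤ.+ Ψ 0            ≡⟨ rotate (+ s 0) (+ Σ′) (Ψ 0) ⟩
  + Σ′ ℤ.+ (Ψ 0 ℤ.+ + s 0)          ≡⟨ cong (ℤ._+_ (+ Σ′)) (step 0 (s≤s z≤n)) ⟨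
  + Σ′ ℤ.+ (Ψ 1 ℤ.+ + m)            ≡⟨ ℤP.+-assoc (+ Σ′) (Ψ 1) (+ m) ⟨
  + Σ′ ℤ.+ Ψ 1 ℤ.+ + m              ≡⟨ cong (λ z → z ℤ.+ + m) (telescope n (s ∘ suc) (Ψ ∘ suc) m (λ j → step (suc j) ∘ s≤s)) ⟩
  Ψ (suc n) ℤ.+ + (n * m) ℤ.+ + m   ≡⟨ swap-last (Ψ (suc n)) (+ (n * m)) (+ m) ⟩
  Ψ (suc n) ℤ.+ (+ m ℤ.+ + (n * m)) ∎
  where
  open ≡-Reasoning
  Σ′ = ∑[ j < n ] s (suc (toℕ j))
  rotate : ∀ (a b c : ℤ) → a ℤ.+ b ℤ.+ c ≡ b ℤ.+ (c ℤ.+ a)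
  rotate = ℤ-solve-∀
  swap-last : ∀ (a b c : ℤ) → a ℤ.+ b ℤ.+ c ≡ a ℤ.+ (c ℤ.+ b)
  swap-last = ℤ-solve-∀

orbitSum-avoiding : ∀ q x f n → IsInc q f → 0 < n → pro^ q n f ≡ f →
                    (∀ j → j < n → ¬ Contains1324 (pro^ q j f)) → orbitSum q x f n ≡ n * suc q
orbitSum-avoiding q x f n inc 0<n periodic avoids = ℤP.+-injective (∙-cancelˡ (Ψ 0) _ _ (begin
  Ψ 0 ℤ.+ + orbitSum q x f n                  ≡⟨ ℤP.+-comm (Ψ 0) _ ⟩
  + orbitSum q x f n ℤ.+ Ψ 0                  ≡⟨ cong (λ k → + k ℤ.+ Ψ 0) (sum-map-applyUpTo (λ j → A x (pro^ q j f)) id n) ⟩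
  + (∑[ j < n ] A x (pro^ q (toℕ j) f)) ℤ.+ Ψ 0 ≡⟨ telescope n (λ j → A x (pro^ q j f)) Ψ (suc q) step ⟩
  Ψ n ℤ.+ + (n * suc q)                       ≡⟨ cong (λ g → Φ (pairOf x) q g ℤ.+ + (n * suc q)) periodic ⟩
  Ψ 0 ℤ.+ + (n * suc q)                       ∎))
  where
  open ≡-Reasoning
  Ψ : ℕ → ℤ
  Ψ j = Φ (pairOf x) q (pro^ q j f)
  avoids-next : ∀ j → j < n → ¬ Contains1324 (pro^ q (suc j) f)
  avoids-next j j<n with suc j ≟ n
  ... | yes refl    = subst (¬_ ∘ Contains1324) (sym periodic) (avoids 0 0<n)
  ... | no 1+j≢n    = avoids (suc j) (≤∧≢⇒< j<n 1+j≢n)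
  step : ∀ j → j < n → Ψ (suc j) ℤ.+ + suc q ≡ Ψ j ℤ.+ + A x (pro^ q j f)
  step j j<n = trans (Φ-step (pairOf x) q (pro^ q j f) (pro^-increasing (IsInc⇒Increasing f inc) j) (avoids-next j j<n))
                     (cong (ℤ._+_ (Ψ j)) (σ-labels-pairOf x (pro^ q j f)))

label : ∀ {q} → Fin q → ℕ
label i = suc (toℕ i)

∑vecs : ∀ q n → (Vec ℕ n → ℕ) → ℕ
∑vecs q zero    h = h []
∑vecs q (suc n) h = ∑[ i < q ] ∑vecs q n (h ∘ (label i ∷_))

sum-vecs : ∀ q n (h : Vec ℕ n → ℕ) → sum (List.map h (vecs q n)) ≡ ∑vecs q n h
sum-vecs q zero    h = +-identityʳ (h [])
sum-vecs q (suc n) h = begin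
  sum (List.map h (concatMap (λ a → List.map (a ∷_) (vecs q n)) (List.map suc (upTo q))))
    ≡⟨ sum-map-concatMap h (λ a → List.map (a ∷_) (vecs q n)) (List.map suc (upTo q)) ⟩
  sum (List.map (λ a → sum (List.map h (List.map (a ∷_) (vecs q n)))) (List.map suc (upTo q)))
    ≡⟨ cong (λ as → sum (List.map (λ a → sum (List.map h (List.map (a ∷_) (vecs q n)))) as)) (map-applyUpTo id suc q) ⟩
  sum (List.map (λ a → sum (List.map h (List.map (a ∷_) (vecs q n)))) (applyUpTo suc q))
    ≡⟨ sum-map-applyUpTo (λ a → sum (List.map h (List.map (a ∷_) (vecs q n)))) suc q ⟩
  ∑[ i < q ] sum (List.map h (List.map (label i ∷_) (vecs q n)))
    ≡⟨ sum-cong-≗ {q} (λ i → trans (cong sum (sym (map-∘ {g = h} {f = label i ∷_} (vecs q n)))) (sum-vecs q n (h ∘ (label i ∷_)))) ⟩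
  ∑[ i < q ] ∑vecs q n (h ∘ (label i ∷_)) ∎
  where open ≡-Reasoning

∑-opposite : ∀ {n} (f : Fin n → ℕ) → ∑[ i < n ] f (opposite i) ≡ ∑[ i < n ] f i
∑-opposite f = sym (∑-permute f reverse)

∑-reverse₄ : ∀ {n} (H : Fin n → Fin n → Fin n → Fin n → ℕ) →
             ∑[ i < n ] ∑[ j < n ] ∑[ k < n ] ∑[ l < n ] H l k j i ≡ ∑[ i < n ] ∑[ j < n ] ∑[ k < n ] ∑[ l < n ] H i j k l
∑-reverse₄ {n} H = begin
  ∑[ i < n ] ∑[ j < n ] ∑[ k < n ] ∑[ l < n ] H l k j i ≡⟨ sum-cong-≗ {n} (λ i → sum-cong-≗ {n} (λ j → ∑-comm (λ k l → H l k j i))) ⟩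
  ∑[ i < n ] ∑[ j < n ] ∑[ l < n ] ∑[ k < n ] H l k j i ≡⟨ sum-cong-≗ {n} (λ i → ∑-comm (λ j l → ∑[ k < n ] H l k j i)) ⟩
  ∑[ i < n ] ∑[ l < n ] ∑[ j < n ] ∑[ k < n ] H l k j i ≡⟨ ∑-comm (λ i l → ∑[ j < n ] ∑[ k < n ] H l k j i) ⟩
  ∑[ l < n ] ∑[ i < n ] ∑[ j < n ] ∑[ k < n ] H l k j i ≡⟨ sum-cong-≗ {n} (λ l → sum-cong-≗ {n} (λ i → ∑-comm (λ j k → H l k j i))) ⟩
  ∑[ l < n ] ∑[ i < n ] ∑[ k < n ] ∑[ j < n ] H l k j i ≡⟨ sum-cong-≗ {n} (λ l → ∑-comm (λ i k → ∑[ j < n ] H l k j i)) ⟩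
  ∑[ l < n ] ∑[ k < n ] ∑[ i < n ] ∑[ j < n ] H l k j i ≡⟨ sum-cong-≗ {n} (λ l → sum-cong-≗ {n} (λ k → ∑-comm (λ i j → H l k j i))) ⟩
  ∑[ l < n ] ∑[ k < n ] ∑[ j < n ] ∑[ i < n ] H l k j i ∎
  where open ≡-Reasoning

∑vecs-reverse : ∀ q (h : Labeling → ℕ) → ∑vecs q 4 (h ∘ Vec.reverse) ≡ ∑vecs q 4 h
∑vecs-reverse q h = ∑-reverse₄ {q} (λ i j k l → h (label i ∷ label j ∷ label k ∷ label l ∷ []))

∸-label : ∀ {q} (i : Fin q) → suc q ∸ label i ≡ label (opposite i)
∸-label i = trans (+-∸-assoc 1 (toℕ<n i)) (cong suc (sym (opposite-prop i)))

∑vecs-reflect : ∀ q n (h : Vec ℕ n → ℕ) → ∑vecs q n (h ∘ Vec.map (suc q ∸_)) ≡ ∑vecs q n h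
∑vecs-reflect q zero    h = refl
∑vecs-reflect q (suc n) h = begin
  ∑[ i < q ] ∑vecs q n (h ∘ Vec.map (suc q ∸_) ∘ (label i ∷_))
    ≡⟨ sum-cong-≗ {q} (λ i → cong (λ a → ∑vecs q n (λ v → h (a ∷ Vec.map (suc q ∸_) v))) (∸-label i)) ⟩
  ∑[ i < q ] ∑vecs q n (h ∘ (label (opposite i) ∷_) ∘ Vec.map (suc q ∸_))
    ≡⟨ sum-cong-≗ {q} (λ i → ∑vecs-reflect q n (h ∘ (label (opposite i) ∷_))) ⟩
  ∑[ i < q ] ∑vecs q n (h ∘ (label (opposite i) ∷_))
    ≡⟨ ∑-opposite {q} (λ i → ∑vecs q n (h ∘ (label i ∷_))) ⟩
  ∑[ i < q ] ∑vecs q n (h ∘ (label i ∷_)) ∎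
  where open ≡-Reasoning

-- The labeling x ↦ q + 1 − f (κ x).
complement : ℕ → Labeling → Labeling
complement q f = Vec.map (suc q ∸_) (Vec.reverse f)

sum-vecs-complement : ∀ q (h : Labeling → ℕ) → sum (List.map (h ∘ complement q) (vecs q 4)) ≡ sum (List.map h (vecs q 4))
sum-vecs-complement q h = begin
  sum (List.map (h ∘ complement q) (vecs q 4)) ≡⟨ sum-vecs q 4 (h ∘ complement q) ⟩
  ∑vecs q 4 (h ∘ complement q)                 ≡⟨ ∑vecs-reverse q (h ∘ Vec.map (suc q ∸_)) ⟩
  ∑vecs q 4 (h ∘ Vec.map (suc q ∸_))           ≡⟨ ∑vecs-reflect q 4 h ⟩
  ∑vecs q 4 h                                  ≡⟨ sum-vecs q 4 h ⟨
  sum (List.map h (vecs q 4))                  ∎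
  where open ≡-Reasoning

1≤∸⇒≤ : ∀ {q x} → 1 ≤ suc q ∸ x → x ≤ q
1≤∸⇒≤ 1≤q+1∸x = ≤-pred (m∸n≢0⇒n<m (>⇒≢ 1≤q+1∸x))

∸≤⇒1≤ : ∀ {q x} → suc q ∸ x ≤ q → 1 ≤ x
∸≤⇒1≤ {x = zero}  q+1≤q = contradiction q+1≤q (n≮n _)
∸≤⇒1≤ {x = suc x} _     = s≤s z≤n

complement-increasing : ∀ {q} f → Increasing q f → Increasing q (complement q f)
complement-increasing {q} (a ∷ b ∷ c ∷ d ∷ []) (1≤a , a<b , 1≤c , c<b , c<d , b≤q , d≤q) =
  m<n⇒0<n∸m (s≤s d≤q) , ∸-monoʳ-< c<d (m≤n⇒m≤1+n d≤q) , m<n⇒0<n∸m (s≤s b≤q) ,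
  ∸-monoʳ-< c<b (m≤n⇒m≤1+n b≤q) , ∸-monoʳ-< a<b (m≤n⇒m≤1+n b≤q) , ∸≤ 1≤c , ∸≤ 1≤a
  where
  ∸≤ : ∀ {x} → 1 ≤ x → suc q ∸ x ≤ q
  ∸≤ (s≤s {n = x} _) = m∸n≤m q x

complement-increasing⁻ : ∀ {q} f → Increasing q (complement q f) → Increasing q f
complement-increasing⁻ (a ∷ b ∷ c ∷ d ∷ []) (1≤q+1∸d , q+1∸d<q+1∸c , 1≤q+1∸b , q+1∸b<q+1∸c , q+1∸b<q+1∸a , q+1∸c≤q , q+1∸a≤q) =
  ∸≤⇒1≤ q+1∸a≤q , ∸-cancelʳ-< q+1∸b<q+1∸a , ∸≤⇒1≤ q+1∸c≤q , ∸-cancelʳ-< q+1∸b<q+1∸c , ∸-cancelʳ-< q+1∸d<q+1∸c ,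
  1≤∸⇒≤ 1≤q+1∸b , 1≤∸⇒≤ 1≤q+1∸d

T-extensional : ∀ {x y} → (T x → T y) → (T y → T x) → x ≡ y
T-extensional {false} {false} _ _ = refl
T-extensional {false} {true}  _ g = contradiction _ g
T-extensional {true}  {false} f _ = contradiction _ f
T-extensional {true}  {true}  _ _ = refl

isIncᵇ-complement : ∀ q f → isIncᵇ q (complement q f) ≡ isIncᵇ q f
isIncᵇ-complement q f@(_ ∷ _ ∷ _ ∷ _ ∷ []) = T-extensional
  (Increasing⇒IsInc f ∘ complement-increasing⁻ f ∘ IsInc⇒Increasing (complement q f))
  (Increasing⇒IsInc (complement q f) ∘ complement-increasing f ∘ IsInc⇒Increasing f)

antipodal-pair : ∀ Q u v → u ≤ Q → v ≤ Q → u + v + (Q ∸ v + (Q ∸ u)) ≡ 2 * Q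
antipodal-pair Q u v u≤Q v≤Q = begin
  u + v + (Q ∸ v + (Q ∸ u))     ≡⟨ shuffle u v (Q ∸ v) (Q ∸ u) ⟩
  (u + (Q ∸ u)) + (v + (Q ∸ v)) ≡⟨ cong₂ _+_ (m+[n∸m]≡n u≤Q) (m+[n∸m]≡n v≤Q) ⟩
  Q + Q                         ≡⟨ cong (_+_ Q) (+-identityʳ Q) ⟨
  2 * Q                         ∎
  where
  open ≡-Reasoning
  shuffle : ∀ a b c d → a + b + (c + d) ≡ (a + d) + (b + c)
  shuffle = solve-∀

labels≤ : ∀ {q a b c d} → Increasing q (a ∷ b ∷ c ∷ d ∷ []) → a ≤ suc q × b ≤ suc q × c ≤ suc q × d ≤ suc q
labels≤ (_ , a<b , _ , c<b , _ , b≤q , d≤q) = ≤-trans (<⇒≤ a<b) b≤ , b≤ , ≤-trans (<⇒≤ c<b) b≤ , m≤n⇒m≤1+n d≤q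
  where b≤ = m≤n⇒m≤1+n b≤q

A-complement : ∀ q x f → Increasing q f → A x f + A x (complement q f) ≡ 2 * suc q
A-complement q zero                   (a ∷ b ∷ c ∷ d ∷ []) inc =
  let a≤ , _ , _ , d≤ = labels≤ inc in antipodal-pair (suc q) a d a≤ d≤
A-complement q (suc zero)             (a ∷ b ∷ c ∷ d ∷ []) inc =
  let _ , b≤ , c≤ , _ = labels≤ inc in antipodal-pair (suc q) b c b≤ c≤
A-complement q (suc (suc zero))       (a ∷ b ∷ c ∷ d ∷ []) inc =
  let _ , b≤ , c≤ , _ = labels≤ inc in antipodal-pair (suc q) c b c≤ b≤
A-complement q (suc (suc (suc zero))) (a ∷ b ∷ c ∷ d ∷ []) inc =
  let a≤ , _ , _ , d≤ = labels≤ inc in antipodal-pair (suc q) d a d≤ a≤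

onInc : ℕ → (Labeling → ℕ) → Labeling → ℕ
onInc q h f = if isIncᵇ q f then h f else 0

onInc-complement : ∀ q x f → onInc q (A x) f + onInc q (A x) (complement q f) ≡ 2 * suc q * onInc q (const 1) f
onInc-complement q x f rewrite isIncᵇ-complement q f with isIncᵇ q f in isInc
... | false = sym (*-zeroʳ (2 * suc q))
... | true  = trans (A-complement q x f (IsInc⇒Increasing f (subst T (sym isInc) _))) (sym (*-identityʳ (2 * suc q)))

totalSum≡[1+q]*|Inc| : ∀ q x → totalSum q x ≡ suc q * length (incList q)
totalSum≡[1+q]*|Inc| q x = *-cancelˡ-≡ (totalSum q x) (suc q * length (incList q)) 2 (begin
  2 * totalSum q x                                           ≡⟨ cong (2 *_) (sum-map-filter (isIncᵇ q) (A x) (vecs q 4)) ⟩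
  2 * S (onInc q (A x))                                      ≡⟨ cong (_+_ (S (onInc q (A x)))) (+-identityʳ _) ⟩
  S (onInc q (A x)) + S (onInc q (A x))                      ≡⟨ cong (_+_ (S (onInc q (A x)))) (sum-vecs-complement q (onInc q (A x))) ⟨
  S (onInc q (A x)) + S (onInc q (A x) ∘ complement q)       ≡⟨ sum-map-+ (onInc q (A x)) (onInc q (A x) ∘ complement q) (vecs q 4) ⟨
  S (λ f → onInc q (A x) f + onInc q (A x) (complement q f)) ≡⟨ cong sum (map-cong (onInc-complement q x) (vecs q 4)) ⟩
  S (λ f → 2 * suc q * onInc q (const 1) f)                  ≡⟨ sum-map-* (2 * suc q) (onInc q (const 1)) (vecs q 4) ⟩
  2 * suc q * S (onInc q (const 1))                          ≡⟨ cong (_*_ (2 * suc q)) (length-filter (isIncᵇ q) (vecs q 4)) ⟨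
  2 * suc q * length (incList q)                             ≡⟨ *-assoc 2 (suc q) _ ⟩
  2 * (suc q * length (incList q))                           ∎)
  where
  open ≡-Reasoning
  S : (Labeling → ℕ) → ℕ
  S h = sum (List.map h (vecs q 4))

proposition7p9 : (q : ℕ) (x : Fin 4) (f : Labeling) → IsInc q f →
    (n : ℕ) → 0 < n → pro^ q n f ≡ f → (∀ m → 0 < m → m < n → pro^ q m f ≢ f) →
    (∀ j → j < n → ¬ Contains1324 (pro^ q j f)) →
    length (incList q) * orbitSum q x f n ≡ n * totalSum q x
proposition7p9 q x f inc n 0<n periodic _ avoids = begin
  length (incList q) * orbitSum q x f n ≡⟨ cong (length (incList q) *_) (orbitSum-avoiding q x f n inc 0<n periodic avoids) ⟩
  length (incList q) * (n * suc q)      ≡⟨ rearrange (length (incList q)) n (suc q) ⟩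
  n * (suc q * length (incList q))      ≡⟨ cong (n *_) (totalSum≡[1+q]*|Inc| q x) ⟨
  n * totalSum q x                      ∎
  where
  open ≡-Reasoning
  rearrange : ∀ a b c → a * (b * c) ≡ b * (c * a)
  rearrange = solve-∀
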